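{- Let $G$ be a connected finite simple graph with $n\ge 3$ vertices and $m$ edges. For each internal vertex $u_i$ (vertex of degree at least $2$) of $G$, let $d_i=\deg_G(u_i)$ and let $m_i$ be the number of neighbours of $u_i$ that are pendant vertices (degree $1$) of $G$, and let $m_1$ be the total number of pendant vertices of $G$. Then the number of edges of the $1$-shunt intersection graph $A_1(G)$ is $$\frac12\sum_{i=1}^{n-m_1}(2d_i-m_i)^2-3m+\frac{5m_1}{2},$$ where the sum runs over the $n-m_1$ internal vertices of $G$.
   Context: A $1$-arc of $G$ is an ordered pair $(u,v)$ with $uv\in E(G)$, written $uv$. A $1$-arc $uv$ can be shunted onto the $1$-arc $vw$ if $w\neq u$ and $vw\in E(G)$. The graph $A_1(G)$ has as vertices the $1$-arcs of $G$ that can be shunted onto some other $1$-arc; two distinct vertices are adjacent iff the corresponding $1$-arcs share at least one vertex of $G$. -}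

module Defs where

open import Data.Nat using (ℕ; zero; suc; _+_; _*_; _∸_; _^_; _≤ᵇ_)
open import Data.Fin using (Fin; _≟_)
open import Data.Bool using (Bool; true; false; T; not; _∧_; _∨_)
open import Data.List using (List; []; _∷_; _++_; map; length; filterᵇ; allFin; concatMap)
open import Data.Nat.ListAction using (sum)
open import Data.Bool.ListAction using (any)
open import Data.Product using (_×_; _,_; proj₁; proj₂)
open import Relation.Nullary using (does)
open import Relation.Binary.PropositionalEquality using (_≡_)

record Graph (n : ℕ) : Set where
  field
    adj     : Fin n → Fin n → Bool
    adj-sym : ∀ u v → adj u v ≡ adj v u
    irrefl  : ∀ u → adj u u ≡ false
open Graph public

module _ {n : ℕ} (G : Graph n) where

  data Reach : Fin n → Fin n → Set where
    here : ∀ {u} → Reach u u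
    step : ∀ {u w v} → T (adj G u w) → Reach w v → Reach u v

  Connected : Set
  Connected = ∀ u v → Reach u v

  deg : Fin n → ℕ
  deg u = length (filterᵇ (adj G u) (allFin n))

  isPendant : Fin n → Bool
  isPendant u = does (deg u Data.Nat.≟ 1)

  isInternal : Fin n → Bool
  isInternal u = 2 ≤ᵇ deg u

  pendantCount : ℕ
  pendantCount = length (filterᵇ isPendant (allFin n))

  pendantNbrs : Fin n → ℕ
  pendantNbrs u = length (filterᵇ (λ v → adj G u v ∧ isPendant v) (allFin n))

  allPairs : List (Fin n × Fin n)
  allPairs = concatMap (λ u → map (u ,_) (allFin n)) (allFin n)

  edgeCount : ℕ
  edgeCount = length (filterᵇ (λ p → adj G (proj₁ p) (proj₂ p) ∧ (Data.Fin.toℕ (proj₁ p) Data.Nat.<ᵇ Data.Fin.toℕ (proj₂ p))) allPairs)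

  isArc : Fin n × Fin n → Bool
  isArc p = adj G (proj₁ p) (proj₂ p)

  shuntable : Fin n × Fin n → Bool
  shuntable p = any (λ w → adj G (proj₂ p) w ∧ not (does (w ≟ proj₁ p))) (allFin n)

  -- vertex set of A₁(G) (a duplicate-free list)
  A1Vertices : List (Fin n × Fin n)
  A1Vertices = filterᵇ (λ p → isArc p ∧ shuntable p) allPairs

  eqF : Fin n → Fin n → Bool
  eqF a b = does (a ≟ b)

  shareVertex : (Fin n × Fin n) → (Fin n × Fin n) → Bool
  shareVertex (a , b) (c , d) = eqF a c ∨ eqF a d ∨ eqF b c ∨ eqF b d

  unorderedPairs : {A : Set} → List A → List (A × A)
  unorderedPairs []       = []
  unorderedPairs (x ∷ xs) = map (x ,_) xs ++ unorderedPairs xs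

  A1EdgeCount : ℕ
  A1EdgeCount = length (filterᵇ (λ q → shareVertex (proj₁ q) (proj₂ q)) (unorderedPairs A1Vertices))

  internalSum : ℕ
  internalSum = sum (map (λ u → (2 * deg u ∸ pendantNbrs u) ^ 2) (filterᵇ isInternal (allFin n)))

-- Let w u v ∈ {0, 1} record whether uv is a vertex of A₁(G). This is the case iff uv ∈ E(G) and v
-- is internal, since uv can be shunted exactly when v has a neighbour besides u. For any loopless
-- 0/1 family of arcs, counting the ordered pairs of arcs that share a vertex by inclusion–exclusion
-- gives
--   2 |E(A₁)| + 2 |V(A₁)| + X = Σₓ s(x)²,
-- where s(x) is the number of arcs at x and X the number of arcs whose reverse is also an arc.
-- An internal vertex of degree d with m pendant neighbours carries d incoming and d − m outgoing
-- arcs, so s = 2d − m; a pendant vertex carries a single outgoing arc, because in a connected graph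
-- on n ≥ 3 vertices its neighbour is internal. Finally |V(A₁)| + m₁ = 2m, the missing arcs being
-- those into pendant vertices, and X + m₁ = |V(A₁)|, the arcs without reverse being those out of
-- pendant vertices; eliminating |V(A₁)| and X gives the formula.

module Submission where

open import Defs

module Counting where

  open import Data.Bool using (Bool; true; false; T; not; _∧_; _∨_)
  open import Data.Bool.Properties using (∨-assoc; ∨-comm; T-∧; T-≡)
  open import Data.Empty using (⊥-elim)
  open import Data.Fin using (Fin; zero; suc; toℕ; _≟_)
  open import Data.Fin.Properties using (toℕ-injective)
  open import Data.List using (List; []; _∷_; _++_; map; length; filterᵇ; allFin; tabulate; concatMap)
  open import Data.List.Membership.Propositional using (lose)
  open import Data.List.Membership.Propositional.Properties using (∈-allFin)
  open import Data.List.Properties using (map-++; map-tabulate; map-∘; map-cong)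
  open import Data.List.Relation.Unary.Any using (satisfied)
  open import Data.List.Relation.Unary.Any.Properties using (any⁺; any⁻)
  open import Data.Nat using (ℕ; zero; suc; _+_; _*_; _∸_; _^_; _≤_; _≤ᵇ_; _<ᵇ_; z≤n; s≤s)
  import Data.Nat as ℕ
  open import Data.Nat.ListAction using (sum)
  open import Data.Nat.ListAction.Properties using (sum-++)
  open import Data.Nat.Properties hiding (_≟_)
  open import Algebra.Properties.CommutativeSemigroup +-commutativeSemigroup
    using () renaming (interchange to +-interchange)
  open import Algebra.Properties.Semiring.Sum +-*-semiring
    using (sum-syntax; sum-cong-≗; sum-replicate-zero; ∑-distrib-+; ∑-comm; *-distribˡ-sum; *-distribʳ-sum)
  open import Data.Nat.Tactic.RingSolver using (solve-∀)
  open import Data.Product using (_×_; _,_; proj₁; proj₂)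
  open import Data.Sum using (_⊎_; inj₁; inj₂)
  open import Function using (_∘_)
  open import Function.Bundles using (Equivalence)
  open import Relation.Binary.PropositionalEquality
  open import Relation.Nullary using (does; yes; no)
  open import Relation.Nullary.Decidable using (dec-true; dec-false)
  open import Relation.Nullary.Negation using (contradiction)
  open import Relation.Nullary.Reflects using (ofʸ; ofⁿ)

  χ : Bool → ℕ
  χ true  = 1
  χ false = 0

  χ-∧ : ∀ a b → χ (a ∧ b) ≡ χ a * χ b
  χ-∧ true  b = sym (+-identityʳ (χ b))
  χ-∧ false b = refl

  χ-T : ∀ {b} → T b → χ b ≡ 1
  χ-T {true} _ = refl

  T-ext : ∀ {a b} → (T a → T b) → (T b → T a) → a ≡ b
  T-ext {false} {false} _ _ = refl
  T-ext {false} {true}  _ g = ⊥-elim (g _)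
  T-ext {true}  {false} f _ = ⊥-elim (f _)
  T-ext {true}  {true}  _ _ = refl

  module _ {A : Set} where

    sum-map-+ : ∀ (f g : A → ℕ) xs → sum (map (λ x → f x + g x) xs) ≡ sum (map f xs) + sum (map g xs)
    sum-map-+ f g []       = refl
    sum-map-+ f g (x ∷ xs) =
      trans (cong (f x + g x +_) (sum-map-+ f g xs)) (+-interchange (f x) (g x) _ _)

    length≡sum-map-1 : ∀ (xs : List A) → length xs ≡ sum (map (λ _ → 1) xs)
    length≡sum-map-1 []       = refl
    length≡sum-map-1 (_ ∷ xs) = cong suc (length≡sum-map-1 xs)

    length-filterᵇ : ∀ (p : A → Bool) xs → length (filterᵇ p xs) ≡ sum (map (χ ∘ p) xs)
    length-filterᵇ p []       = refl
    length-filterᵇ p (x ∷ xs) with p x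
    ... | true  = cong suc (length-filterᵇ p xs)
    ... | false = length-filterᵇ p xs

    sum-map-filterᵇ : ∀ (p : A → Bool) (f : A → ℕ) xs →
      sum (map f (filterᵇ p xs)) ≡ sum (map (λ x → χ (p x) * f x) xs)
    sum-map-filterᵇ p f []       = refl
    sum-map-filterᵇ p f (x ∷ xs) with p x
    ... | true  = cong₂ _+_ (sym (+-identityʳ (f x))) (sum-map-filterᵇ p f xs)
    ... | false = sum-map-filterᵇ p f xs

    sum-map-concatMap : ∀ {B : Set} (g : A → List B) (f : B → ℕ) xs →
      sum (map f (concatMap g xs)) ≡ sum (map (sum ∘ map f ∘ g) xs)
    sum-map-concatMap g f []       = refl
    sum-map-concatMap g f (x ∷ xs) = begin
      sum (map f (g x ++ concatMap g xs))              ≡⟨ cong sum (map-++ f (g x) _) ⟩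
      sum (map f (g x) ++ map f (concatMap g xs))      ≡⟨ sum-++ (map f (g x)) _ ⟩
      sum (map f (g x)) + sum (map f (concatMap g xs))
        ≡⟨ cong (sum (map f (g x)) +_) (sum-map-concatMap g f xs) ⟩
      sum (map (sum ∘ map f ∘ g) (x ∷ xs))             ∎
      where open ≡-Reasoning

  sum-tabulate : ∀ {n} (f : Fin n → ℕ) → sum (tabulate f) ≡ ∑[ i < n ] f i
  sum-tabulate {zero}  f = refl
  sum-tabulate {suc n} f = cong (f zero +_) (sum-tabulate (f ∘ suc))

  sum-map-allFin : ∀ {n} (f : Fin n → ℕ) → sum (map f (allFin n)) ≡ ∑[ i < n ] f i
  sum-map-allFin {n} f = trans (cong sum (map-tabulate (λ i → i) f)) (sum-tabulate f)

  ∑-mono-≤ : ∀ {n} {f g : Fin n → ℕ} → (∀ i → f i ≤ g i) → ∑[ i < n ] f i ≤ ∑[ i < n ] g i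
  ∑-mono-≤ {zero}  f≤g = z≤n
  ∑-mono-≤ {suc n} f≤g = +-mono-≤ (f≤g zero) (∑-mono-≤ (f≤g ∘ suc))

  δ : ∀ {n} → Fin n → Fin n → ℕ
  δ a b = χ (does (a ≟ b))

  ∑-δ : ∀ {n} (a : Fin n) (g : Fin n → ℕ) → ∑[ x < n ] (δ a x * g x) ≡ g a
  ∑-δ {suc n} zero    g =
    trans (cong₂ _+_ (+-identityʳ (g zero)) (sum-replicate-zero n)) (+-identityʳ (g zero))
  ∑-δ {suc n} (suc a) g = ∑-δ a (g ∘ suc)

  ∑-δ-one : ∀ {n} (a : Fin n) → ∑[ x < n ] δ a x ≡ 1
  ∑-δ-one {n} a = trans (sum-cong-≗ (λ x → sym (*-identityʳ (δ a x)))) (∑-δ a (λ _ → 1))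

  module _ {n : ℕ} {p : Fin n → Bool} where

    δ≤χ : ∀ {w} → T (p w) → ∀ y → δ w y ≤ χ (p y)
    δ≤χ {w} pw y with w ≟ y
    ... | yes refl = ≤-reflexive (sym (χ-T pw))
    ... | no _     = z≤n

    count-≥1 : ∀ {w} → T (p w) → 1 ≤ ∑[ y < n ] χ (p y)
    count-≥1 {w} pw = subst (_≤ _) (∑-δ-one w) (∑-mono-≤ (δ≤χ pw))

    count-≥2 : ∀ {w u} → w ≢ u → T (p w) → T (p u) → 2 ≤ ∑[ y < n ] χ (p y)
    count-≥2 {w} {u} w≢u pw pu = begin
      2                                   ≡⟨ cong₂ _+_ (∑-δ-one w) (∑-δ-one u) ⟨
      ∑[ y < n ] δ w y + ∑[ y < n ] δ u y ≡⟨ ∑-distrib-+ (δ w) (δ u) ⟨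
      ∑[ y < n ] (δ w y + δ u y)          ≤⟨ ∑-mono-≤ bound ⟩
      ∑[ y < n ] χ (p y)                  ∎
      where
      open ≤-Reasoning
      bound : ∀ y → δ w y + δ u y ≤ χ (p y)
      bound y with w ≟ y | u ≟ y
      ... | yes refl | yes refl = ⊥-elim (w≢u refl)
      ... | yes refl | no _     = ≤-reflexive (sym (χ-T pw))
      ... | no _     | yes refl = ≤-reflexive (sym (χ-T pu))
      ... | no _     | no _     = z≤n

    count-≤1 : ∀ {u} → (∀ y → T (p y) → y ≡ u) → ∑[ y < n ] χ (p y) ≤ 1
    count-≤1 {u} only-u = subst (_ ≤_) (∑-δ-one u) (∑-mono-≤ bound)
      where
      bound : ∀ y → χ (p y) ≤ δ u y
      bound y with p y in py
      ... | false = z≤n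
      ... | true rewrite only-u y (subst T (sym py) _) | dec-true (u ≟ u) refl = ≤-refl

  -- Counting related pairs in a list

  -- G is only there because unorderedPairs is defined inside the graph module of Defs.
  module _ {n : ℕ} (G : Graph n) {A : Set} (R : A → A → Bool)
           (R-sym : ∀ a b → R a b ≡ R b a) (R-refl : ∀ a → R a a ≡ true) where

    private
      related : List A → ℕ
      related xs = sum (map (λ q → χ (R (proj₁ q) (proj₂ q))) (unorderedPairs G xs))

      relatedTo : A → List A → ℕ
      relatedTo a xs = sum (map (χ ∘ R a) xs)

      total : List A → ℕ
      total xs = sum (map (λ a → relatedTo a xs) xs)

      related-∷ : ∀ x ys → related (x ∷ ys) ≡ relatedTo x ys + related ys
      related-∷ x ys = begin
        related (x ∷ ys)
          ≡⟨ cong sum (map-++ _ (map (x ,_) ys) (unorderedPairs G ys)) ⟩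
        sum (map (λ q → χ (R (proj₁ q) (proj₂ q))) (map (x ,_) ys) ++ map _ (unorderedPairs G ys))
          ≡⟨ sum-++ (map _ (map (x ,_) ys)) _ ⟩
        sum (map (λ q → χ (R (proj₁ q) (proj₂ q))) (map (x ,_) ys)) + related ys
          ≡⟨ cong (λ s → sum s + related ys) (map-∘ ys) ⟨
        relatedTo x ys + related ys ∎
        where open ≡-Reasoning

      total-∷ : ∀ x ys → total (x ∷ ys) ≡ suc (relatedTo x ys) + (relatedTo x ys + total ys)
      total-∷ x ys = begin
        χ (R x x) + relatedTo x ys + sum (map (λ a → χ (R a x) + relatedTo a ys) ys)
          ≡⟨ cong (χ (R x x) + relatedTo x ys +_)
                  (sum-map-+ (λ a → χ (R a x)) (λ a → relatedTo a ys) ys) ⟩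
        χ (R x x) + relatedTo x ys + (sum (map (λ a → χ (R a x)) ys) + total ys)
          ≡⟨ cong₂ (λ r s → χ r + relatedTo x ys + (s + total ys))
                   (R-refl x) (cong sum (map-cong (λ a → cong χ (R-sym a x)) ys)) ⟩
        suc (relatedTo x ys) + (relatedTo x ys + total ys) ∎
        where open ≡-Reasoning

      double-related : ∀ xs → 2 * related xs + length xs ≡ total xs
      double-related []       = refl
      double-related (x ∷ ys) = begin
        2 * related (x ∷ ys) + suc (length ys)
          ≡⟨ cong (λ r → 2 * r + suc (length ys)) (related-∷ x ys) ⟩
        2 * (relatedTo x ys + related ys) + suc (length ys)
          ≡⟨ rearrange (relatedTo x ys) (related ys) (length ys) ⟩
        suc (relatedTo x ys) + (relatedTo x ys + (2 * related ys + length ys))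
          ≡⟨ cong (λ t → suc (relatedTo x ys) + (relatedTo x ys + t)) (double-related ys) ⟩
        suc (relatedTo x ys) + (relatedTo x ys + total ys)
          ≡⟨ total-∷ x ys ⟨
        total (x ∷ ys) ∎
        where
        open ≡-Reasoning
        rearrange : ∀ c r l → 2 * (c + r) + suc l ≡ suc c + (c + (2 * r + l))
        rearrange = solve-∀

    unorderedPairs-count : ∀ xs →
      2 * length (filterᵇ (λ q → R (proj₁ q) (proj₂ q)) (unorderedPairs G xs)) + length xs
        ≡ sum (map (λ a → sum (map (χ ∘ R a) xs)) xs)
    unorderedPairs-count xs =
      trans (cong (λ k → 2 * k + length xs) (length-filterᵇ _ (unorderedPairs G xs))) (double-related xs)

  -- Families of arcs and the pairs of arcs that meet

  _meets_ : ∀ {n} → Fin n × Fin n → Fin n × Fin n → Bool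
  (a , b) meets (c , d) = does (a ≟ c) ∨ does (a ≟ d) ∨ does (b ≟ c) ∨ does (b ≟ d)

  meets-inclusion-exclusion : ∀ {n} {u v r t : Fin n} → u ≢ v → r ≢ t →
    χ ((u , v) meets (r , t)) + δ u r * δ v t + δ v r * δ u t ≡ δ u r + δ u t + δ v r + δ v t
  meets-inclusion-exclusion {u = u} {v} {r} {t} u≢v r≢t with u ≟ r | u ≟ t | v ≟ r | v ≟ t
  ... | yes refl | yes refl | _        | _        = ⊥-elim (r≢t refl)
  ... | _        | _        | yes refl | yes refl = ⊥-elim (r≢t refl)
  ... | yes refl | _        | yes refl | _        = ⊥-elim (u≢v refl)
  ... | _        | yes refl | _        | yes refl = ⊥-elim (u≢v refl)
  ... | no _     | no _     | no _     | no _     = refl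
  ... | yes _    | no _     | no _     | no _     = refl
  ... | no _     | yes _    | no _     | no _     = refl
  ... | no _     | no _     | yes _    | no _     = refl
  ... | no _     | no _     | no _     | yes _    = refl
  ... | yes _    | no _     | no _     | yes _    = refl
  ... | no _     | yes _    | yes _    | no _     = refl

  does-≟-sym : ∀ {n} (a b : Fin n) → does (a ≟ b) ≡ does (b ≟ a)
  does-≟-sym a b with a ≟ b
  ... | yes refl = sym (dec-true (a ≟ a) refl)
  ... | no a≢b   = sym (dec-false (b ≟ a) (a≢b ∘ sym))

  meets-refl : ∀ {n} (p : Fin n × Fin n) → p meets p ≡ true
  meets-refl (a , b) rewrite dec-true (a ≟ a) refl = refl

  meets-sym : ∀ {n} (p q : Fin n × Fin n) → p meets q ≡ q meets p
  meets-sym (a , b) (c , d)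
    rewrite does-≟-sym c a | does-≟-sym c b | does-≟-sym d a | does-≟-sym d b =
    cong (does (a ≟ c) ∨_) (∨-swap (does (a ≟ d)) (does (b ≟ c)) (does (b ≟ d)))
    where
    ∨-swap : ∀ x y z → x ∨ (y ∨ z) ≡ y ∨ (x ∨ z)
    ∨-swap x y z = trans (sym (∨-assoc x y z)) (trans (cong (_∨ z) (∨-comm x y)) (∨-assoc y x z))

  module ArcFamily {n : ℕ} (arc : Fin n → Fin n → Bool) (arc-irrefl : ∀ x → arc x x ≡ false) where

    w : Fin n → Fin n → ℕ
    w u v = χ (arc u v)

    ⟪_⟫ : (Fin n → Fin n → ℕ) → ℕ
    ⟪ g ⟫ = ∑[ u < n ] ∑[ v < n ] (w u v * g u v)

    outdeg indeg incidence : Fin n → ℕ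
    outdeg u = ∑[ v < n ] w u v
    indeg v = ∑[ u < n ] w u v
    incidence x = outdeg x + indeg x

    arc⇒≢ : ∀ {u v} → T (arc u v) → u ≢ v
    arc⇒≢ {u} uv refl rewrite arc-irrefl u = uv

    ⟪⟫-cong : ∀ {g h} → (∀ u v → T (arc u v) → g u v ≡ h u v) → ⟪ g ⟫ ≡ ⟪ h ⟫
    ⟪⟫-cong {g} {h} g≡h = sum-cong-≗ λ u → sum-cong-≗ λ v → on-arcs u v
      where
      on-arcs : ∀ u v → w u v * g u v ≡ w u v * h u v
      on-arcs u v with arc u v in uv
      ... | false = refl
      ... | true  = cong (1 *_) (g≡h u v (subst T (sym uv) _))

    ⟪⟫-+ : ∀ (g h : Fin n → Fin n → ℕ) → ⟪ (λ u v → g u v + h u v) ⟫ ≡ ⟪ g ⟫ + ⟪ h ⟫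
    ⟪⟫-+ g h = trans (sum-cong-≗ λ u → trans (sum-cong-≗ λ v → *-distribˡ-+ (w u v) (g u v) (h u v))
                                           (∑-distrib-+ (λ v → w u v * g u v) (λ v → w u v * h u v)))
                     (∑-distrib-+ (λ u → ∑[ v < n ] (w u v * g u v)) (λ u → ∑[ v < n ] (w u v * h u v)))

    ⟪⟫-source : ∀ (f : Fin n → ℕ) → ⟪ (λ u v → f u) ⟫ ≡ ∑[ u < n ] (f u * outdeg u)
    ⟪⟫-source f = sum-cong-≗ λ u →
      trans (sum-cong-≗ λ v → *-comm (w u v) (f u)) (sym (*-distribˡ-sum (f u) (w u)))

    ⟪⟫-target : ∀ (f : Fin n → ℕ) → ⟪ (λ u v → f v) ⟫ ≡ ∑[ v < n ] (f v * indeg v)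
    ⟪⟫-target f = trans (∑-comm (λ u v → w u v * f v)) (sum-cong-≗ λ v →
      trans (sum-cong-≗ λ u → *-comm (w u v) (f v)) (sym (*-distribˡ-sum (f v) (λ u → w u v))))

    ⟪⟫-δδ : ∀ u v → ⟪ (λ r t → δ u r * δ v t) ⟫ ≡ w u v
    ⟪⟫-δδ u v = trans (sum-cong-≗ row) (∑-δ u (λ r → w r v))
      where
      reorder : ∀ a b c → a * (b * c) ≡ b * (c * a)
      reorder = solve-∀
      row : ∀ r → ∑[ t < n ] (w r t * (δ u r * δ v t)) ≡ δ u r * w r v
      row r = begin
        ∑[ t < n ] (w r t * (δ u r * δ v t)) ≡⟨ sum-cong-≗ (λ t → reorder (w r t) (δ u r) (δ v t)) ⟩
        ∑[ t < n ] (δ u r * (δ v t * w r t)) ≡⟨ *-distribˡ-sum (δ u r) (λ t → δ v t * w r t) ⟨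
        δ u r * ∑[ t < n ] (δ v t * w r t)   ≡⟨ cong (δ u r *_) (∑-δ v (w r)) ⟩
        δ u r * w r v                        ∎
        where open ≡-Reasoning

    meeting : Fin n → Fin n → ℕ
    meeting u v = ⟪ (λ r t → χ ((u , v) meets (r , t))) ⟫

    meeting-count : ∀ {u v} → T (arc u v) → meeting u v + 1 + w v u ≡ incidence u + incidence v
    meeting-count {u} {v} uv = begin
      meeting u v + 1 + w v u
        ≡⟨ cong₂ (λ a b → meeting u v + a + b) (trans (⟪⟫-δδ u v) (χ-T uv)) (⟪⟫-δδ v u) ⟨
      meeting u v + ⟪ (λ r t → δ u r * δ v t) ⟫ + ⟪ (λ r t → δ v r * δ u t) ⟫
        ≡⟨ cong (_+ ⟪ (λ r t → δ v r * δ u t) ⟫) (⟪⟫-+ _ _) ⟨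
      ⟪ (λ r t → χ ((u , v) meets (r , t)) + δ u r * δ v t) ⟫ + ⟪ (λ r t → δ v r * δ u t) ⟫
        ≡⟨ ⟪⟫-+ _ _ ⟨
      ⟪ (λ r t → χ ((u , v) meets (r , t)) + δ u r * δ v t + δ v r * δ u t) ⟫
        ≡⟨ ⟪⟫-cong (λ r t rt → meets-inclusion-exclusion (arc⇒≢ uv) (arc⇒≢ rt)) ⟩
      ⟪ (λ r t → δ u r + δ u t + δ v r + δ v t) ⟫
        ≡⟨ ⟪⟫-+ _ _ ⟩
      ⟪ (λ r t → δ u r + δ u t + δ v r) ⟫ + ⟪ (λ r t → δ v t) ⟫
        ≡⟨ cong (_+ ⟪ (λ r t → δ v t) ⟫)
                (trans (⟪⟫-+ _ _) (cong (_+ ⟪ (λ r t → δ v r) ⟫) (⟪⟫-+ _ _))) ⟩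
      ⟪ (λ r t → δ u r) ⟫ + ⟪ (λ r t → δ u t) ⟫ + ⟪ (λ r t → δ v r) ⟫ + ⟪ (λ r t → δ v t) ⟫
        ≡⟨ cong₂ _+_ (cong₂ _+_ (cong₂ _+_ (source-δ u) (target-δ u)) (source-δ v)) (target-δ v) ⟩
      outdeg u + indeg u + outdeg v + indeg v
        ≡⟨ +-assoc (incidence u) (outdeg v) (indeg v) ⟩
      incidence u + incidence v ∎
      where
      open ≡-Reasoning
      source-δ : ∀ x → ⟪ (λ r t → δ x r) ⟫ ≡ outdeg x
      source-δ x = trans (⟪⟫-source (δ x)) (∑-δ x outdeg)
      target-δ : ∀ x → ⟪ (λ r t → δ x t) ⟫ ≡ indeg x
      target-δ x = trans (⟪⟫-target (δ x)) (∑-δ x indeg)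

    meeting-sum : ⟪ meeting ⟫ + ⟪ (λ _ _ → 1) ⟫ + ⟪ (λ u v → w v u) ⟫
                ≡ ∑[ x < n ] (incidence x * incidence x)
    meeting-sum = begin
      ⟪ meeting ⟫ + ⟪ (λ _ _ → 1) ⟫ + ⟪ (λ u v → w v u) ⟫
        ≡⟨ trans (⟪⟫-+ (λ u v → meeting u v + 1) (λ u v → w v u))
                 (cong (_+ ⟪ (λ u v → w v u) ⟫) (⟪⟫-+ meeting (λ _ _ → 1))) ⟨
      ⟪ (λ u v → meeting u v + 1 + w v u) ⟫
        ≡⟨ ⟪⟫-cong (λ u v → meeting-count) ⟩
      ⟪ (λ u v → incidence u + incidence v) ⟫
        ≡⟨ trans (⟪⟫-+ _ _) (cong₂ _+_ (⟪⟫-source incidence) (⟪⟫-target incidence)) ⟩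
      ∑[ x < n ] (incidence x * outdeg x) + ∑[ x < n ] (incidence x * indeg x)
        ≡⟨ ∑-distrib-+ (λ x → incidence x * outdeg x) (λ x → incidence x * indeg x) ⟨
      ∑[ x < n ] (incidence x * outdeg x + incidence x * indeg x)
        ≡⟨ sum-cong-≗ (λ x → *-distribˡ-+ (incidence x) (outdeg x) (indeg x)) ⟨
      ∑[ x < n ] (incidence x * incidence x) ∎
      where open ≡-Reasoning

  -- Degrees

  internal+pendant : ∀ {d} → 1 ≤ d → χ (2 ≤ᵇ d) + χ (does (d ℕ.≟ 1)) ≡ 1
  internal+pendant {suc zero}    _ = refl
  internal+pendant {suc (suc d)} _ = refl

  internal*deg+pendant : ∀ d → χ (2 ≤ᵇ d) * d + χ (does (d ℕ.≟ 1)) ≡ d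
  internal*deg+pendant zero          = refl
  internal*deg+pendant (suc zero)    = refl
  internal*deg+pendant (suc (suc d)) = trans (+-identityʳ _) (*-identityˡ _)

  -- o and p are the numbers of internal and of pendant neighbours of a vertex of degree d.
  vertex-square : ∀ d o p → o + p ≡ d → (d ≡ 1 → p ≡ 0) →
    χ (2 ≤ᵇ d) * (2 * d ∸ p) ^ 2 + χ (does (d ℕ.≟ 1))
      ≡ (o + χ (2 ≤ᵇ d) * d) * (o + χ (2 ≤ᵇ d) * d)
  vertex-square zero o p o+p≡0 _ rewrite m+n≡0⇒m≡0 o o+p≡0 = refl
  vertex-square (suc zero) o p o+p≡1 pendant with pendant refl
  ... | refl with trans (sym (+-identityʳ o)) o+p≡1
  ...   | refl = refl
  vertex-square (suc (suc d)) o p o+p≡d _ = internal-square o+p≡d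
    where
    -- the goal of the case d = 2 + k, before χ and 1 * _ are simplified
    internal-square : ∀ {d} → o + p ≡ d → 1 * (2 * d ∸ p) ^ 2 + 0 ≡ (o + 1 * d) * (o + 1 * d)
    internal-square refl = begin
      1 * (2 * (o + p) ∸ p) ^ 2 + 0
        ≡⟨ cong (λ k → 1 * (k ∸ p) ^ 2 + 0) (split-double o p) ⟩
      1 * (o + (o + p) + p ∸ p) ^ 2 + 0
        ≡⟨ cong (λ k → 1 * k ^ 2 + 0) (m+n∸n≡m (o + (o + p)) p) ⟩
      1 * (o + (o + p)) ^ 2 + 0
        ≡⟨ expand o p ⟩
      (o + 1 * (o + p)) * (o + 1 * (o + p)) ∎
      where
      open ≡-Reasoning
      split-double : ∀ o p → 2 * (o + p) ≡ o + (o + p) + p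
      split-double = solve-∀
      expand : ∀ o p → 1 * ((o + (o + p)) * ((o + (o + p)) * 1)) + 0 ≡ (o + 1 * (o + p)) * (o + 1 * (o + p))
      expand = solve-∀

  covered-by-two : ∀ {n} {a b : Fin n} → (∀ y → y ≡ a ⊎ y ≡ b) → n ≤ 2
  covered-by-two {zero}                _     = z≤n
  covered-by-two {suc zero}            _     = s≤s z≤n
  covered-by-two {suc (suc zero)}      _     = ≤-refl
  covered-by-two {suc (suc (suc n))} cover with cover zero | cover (suc zero) | cover (suc (suc zero))
  ... | inj₁ refl | inj₁ ()   | _
  ... | inj₂ refl | inj₂ ()   | _
  ... | inj₁ refl | inj₂ refl | inj₁ ()
  ... | inj₁ refl | inj₂ refl | inj₂ ()
  ... | inj₂ refl | inj₁ refl | inj₁ ()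
  ... | inj₂ refl | inj₁ refl | inj₂ ()

  χ-<ᵇ-split : ∀ {n} {u v : Fin n} → u ≢ v → χ (toℕ u <ᵇ toℕ v) + χ (toℕ v <ᵇ toℕ u) ≡ 1
  χ-<ᵇ-split {u = u} {v} u≢v
    with toℕ u <ᵇ toℕ v | <ᵇ-reflects-< (toℕ u) (toℕ v)
       | toℕ v <ᵇ toℕ u | <ᵇ-reflects-< (toℕ v) (toℕ u)
  ... | true  | ofʸ u<v | true  | ofʸ v<u = ⊥-elim (<-asym u<v v<u)
  ... | true  | _       | false | _       = refl
  ... | false | _       | true  | _       = refl
  ... | false | ofⁿ u≮v | false | ofⁿ v≮u =
    ⊥-elim (u≢v (toℕ-injective (≤-antisym (≮⇒≥ v≮u) (≮⇒≥ u≮v))))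

  module _ {n : ℕ} (G : Graph n) where

    adj⇒≢ : ∀ {u v} → T (adj G u v) → u ≢ v
    adj⇒≢ {u} uv refl rewrite irrefl G u = uv

    sum-map-allPairs : ∀ (F : Fin n × Fin n → ℕ) →
      sum (map F (allPairs G)) ≡ ∑[ u < n ] ∑[ v < n ] F (u , v)
    sum-map-allPairs F = begin
      sum (map F (allPairs G))
        ≡⟨ sum-map-concatMap (λ u → map (u ,_) (allFin n)) F (allFin n) ⟩
      sum (map (λ u → sum (map F (map (u ,_) (allFin n)))) (allFin n))
        ≡⟨ cong sum (map-cong (λ u → cong sum (map-∘ (allFin n))) (allFin n)) ⟨
      sum (map (λ u → sum (map (λ v → F (u , v)) (allFin n))) (allFin n))
        ≡⟨ cong sum (map-cong (λ u → sum-map-allFin (λ v → F (u , v))) (allFin n)) ⟩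
      sum (map (λ u → ∑[ v < n ] F (u , v)) (allFin n))
        ≡⟨ sum-map-allFin (λ u → ∑[ v < n ] F (u , v)) ⟩
      ∑[ u < n ] ∑[ v < n ] F (u , v) ∎
      where open ≡-Reasoning

    deg≡∑ : ∀ u → deg G u ≡ ∑[ v < n ] χ (adj G u v)
    deg≡∑ u = trans (length-filterᵇ (adj G u) (allFin n)) (sum-map-allFin (χ ∘ adj G u))

    pendantNbrs≡∑ : ∀ x → pendantNbrs G x ≡ ∑[ v < n ] χ (adj G x v ∧ isPendant G v)
    pendantNbrs≡∑ x =
      trans (length-filterᵇ _ (allFin n)) (sum-map-allFin (λ v → χ (adj G x v ∧ isPendant G v)))

    deg-≥1 : ∀ {u v} → T (adj G u v) → 1 ≤ deg G u
    deg-≥1 {u} uv = subst (1 ≤_) (sym (deg≡∑ u)) (count-≥1 {p = adj G u} uv)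

    deg-≥2 : ∀ {u v w} → v ≢ w → T (adj G u v) → T (adj G u w) → 2 ≤ deg G u
    deg-≥2 {u} v≢w uv uw = subst (2 ≤_) (sym (deg≡∑ u)) (count-≥2 {p = adj G u} v≢w uv uw)

    deg-≤1 : ∀ {u w} → (∀ v → T (adj G u v) → v ≡ w) → deg G u ≤ 1
    deg-≤1 {u} only-w = subst (_≤ 1) (sym (deg≡∑ u)) (count-≤1 {p = adj G u} only-w)

    unique-neighbour : ∀ {u v w} → deg G u ≡ 1 → T (adj G u v) → T (adj G u w) → v ≡ w
    unique-neighbour {v = v} {w} du uv uw with v ≟ w
    ... | yes v≡w = v≡w
    ... | no v≢w  = contradiction (subst (2 ≤_) du (deg-≥2 v≢w uv uw)) λ { (s≤s ()) }

    shuntable≡isInternal : ∀ {u v} → T (adj G u v) → shuntable G (u , v) ≡ isInternal G v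
    shuntable≡isInternal {u} {v} uv =
      T-ext (≤⇒≤ᵇ ∘ shuntable⇒2≤deg) (2≤deg⇒shuntable ∘ ≤ᵇ⇒≤ 2 _)
      where
      vu : T (adj G v u)
      vu = subst T (adj-sym G u v) uv
      other : Fin n → Bool
      other w = adj G v w ∧ not (does (w ≟ u))
      shuntable⇒2≤deg : T (shuntable G (u , v)) → 2 ≤ deg G v
      shuntable⇒2≤deg sh with satisfied (any⁻ other (allFin n) sh)
      ... | w , vw∧not-u with Equivalence.to T-∧ vw∧not-u
      ...   | vw , not-u = deg-≥2 (λ { refl → subst (T ∘ not) (dec-true (w ≟ w) refl) not-u }) vw vu
      2≤deg⇒shuntable : 2 ≤ deg G v → T (shuntable G (u , v))
      2≤deg⇒shuntable 2≤d with shuntable G (u , v) in sh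
      ... | true  = _
      ... | false = contradiction (≤-trans 2≤d (deg-≤1 only-u)) λ { (s≤s ()) }
        where
        only-u : ∀ w → T (adj G v w) → w ≡ u
        only-u w vw with w ≟ u
        ... | yes w≡u = w≡u
        ... | no w≢u  =
          ⊥-elim (subst T sh (any⁺ other (lose (∈-allFin w) (Equivalence.from T-∧ (vw , not-u)))))
          where
          not-u : T (not (does (w ≟ u)))
          not-u = subst (T ∘ not) (sym (dec-false (w ≟ u) w≢u)) _

    handshake : ∑[ u < n ] deg G u ≡ 2 * edgeCount G
    handshake = begin
      ∑[ u < n ] deg G u
        ≡⟨ sum-cong-≗ (λ u → trans (deg≡∑ u) (sum-cong-≗ (adj-split u))) ⟩
      ∑[ u < n ] ∑[ v < n ] (forward u v + forward v u)
        ≡⟨ sum-cong-≗ (λ u → ∑-distrib-+ (forward u) (λ v → forward v u)) ⟩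
      ∑[ u < n ] (∑[ v < n ] forward u v + ∑[ v < n ] forward v u)
        ≡⟨ ∑-distrib-+ (λ u → ∑[ v < n ] forward u v) (λ u → ∑[ v < n ] forward v u) ⟩
      ∑[ u < n ] ∑[ v < n ] forward u v + ∑[ u < n ] ∑[ v < n ] forward v u
        ≡⟨ cong (edges +_) (trans (∑-comm (λ u v → forward v u)) (sym (+-identityʳ edges))) ⟩
      2 * edges
        ≡⟨ cong (2 *_) (trans (length-filterᵇ _ (allPairs G)) (sum-map-allPairs _)) ⟨
      2 * edgeCount G ∎
      where
      open ≡-Reasoning
      forward : Fin n → Fin n → ℕ
      forward u v = χ (adj G u v ∧ (toℕ u <ᵇ toℕ v))
      edges : ℕ
      edges = ∑[ u < n ] ∑[ v < n ] forward u v
      adj-split : ∀ u v → χ (adj G u v) ≡ forward u v + forward v u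
      adj-split u v rewrite adj-sym G v u with adj G u v in uv
      ... | false = refl
      ... | true  = sym (χ-<ᵇ-split (adj⇒≢ (subst T (sym uv) _)))

    isPendant⇒deg≡1 : ∀ {u} → isPendant G u ≡ true → deg G u ≡ 1
    isPendant⇒deg≡1 {u} pu = ≡ᵇ⇒≡ (deg G u) 1 (subst T (sym pu) _)

    pendant-neighbour-not-pendant : Connected G → 3 ≤ n →
      ∀ {x v} → deg G x ≡ 1 → T (adj G x v) → deg G v ≢ 1
    pendant-neighbour-not-pendant connected 3≤n {x} {v} dx xv dv = <⇒≱ 3≤n (covered-by-two stays)
      where
      -- otherwise {x, v} is closed under adjacency, hence by connectivity it is all of G
      closed : ∀ {a b} → Reach G a b → a ≡ x ⊎ a ≡ v → b ≡ x ⊎ b ≡ v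
      closed here         a∈xv        = a∈xv
      closed (step aw wb) (inj₁ refl) = closed wb (inj₂ (unique-neighbour dx aw xv))
      closed (step aw wb) (inj₂ refl) =
        closed wb (inj₁ (unique-neighbour dv aw (subst T (adj-sym G x v) xv)))
      stays : ∀ y → y ≡ x ⊎ y ≡ v
      stays y = closed (connected x y) (inj₁ refl)

  -- The vertices of A₁(G) as a family of arcs

  module A₁-Counting {n : ℕ} (G : Graph n) (connected : Connected G) (3≤n : 3 ≤ n) where

    open ArcFamily (λ u v → adj G u v ∧ isInternal G v) (λ u → cong (_∧ isInternal G u) (irrefl G u))

    indeg≡ : ∀ x → indeg x ≡ χ (isInternal G x) * deg G x
    indeg≡ x = begin
      ∑[ u < n ] χ (adj G u x ∧ isInternal G x)
        ≡⟨ sum-cong-≗ (λ u → χ-∧ (adj G u x) (isInternal G x)) ⟩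
      ∑[ u < n ] (χ (adj G u x) * χ (isInternal G x))
        ≡⟨ *-distribʳ-sum (χ (isInternal G x)) (λ u → χ (adj G u x)) ⟨
      ∑[ u < n ] χ (adj G u x) * χ (isInternal G x)
        ≡⟨ cong (_* χ (isInternal G x)) deg-in ⟩
      deg G x * χ (isInternal G x)
        ≡⟨ *-comm (deg G x) _ ⟩
      χ (isInternal G x) * deg G x ∎
      where
      open ≡-Reasoning
      deg-in : ∑[ u < n ] χ (adj G u x) ≡ deg G x
      deg-in = sym (trans (deg≡∑ G x) (sum-cong-≗ (λ u → cong χ (adj-sym G x u))))

    outdeg+pendantNbrs : ∀ x → outdeg x + pendantNbrs G x ≡ deg G x
    outdeg+pendantNbrs x = begin
      outdeg x + pendantNbrs G x
        ≡⟨ cong (outdeg x +_) (pendantNbrs≡∑ G x) ⟩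
      outdeg x + ∑[ v < n ] χ (adj G x v ∧ isPendant G v)
        ≡⟨ ∑-distrib-+ (λ v → χ (adj G x v ∧ isInternal G v))
                       (λ v → χ (adj G x v ∧ isPendant G v)) ⟨
      ∑[ v < n ] (χ (adj G x v ∧ isInternal G v) + χ (adj G x v ∧ isPendant G v))
        ≡⟨ sum-cong-≗ neighbour-internal-or-pendant ⟩
      ∑[ v < n ] χ (adj G x v)
        ≡⟨ deg≡∑ G x ⟨
      deg G x ∎
      where
      open ≡-Reasoning
      neighbour-internal-or-pendant : ∀ v →
        χ (adj G x v ∧ isInternal G v) + χ (adj G x v ∧ isPendant G v) ≡ χ (adj G x v)
      neighbour-internal-or-pendant v with adj G x v in xv
      ... | false = refl
      ... | true  = internal+pendant (deg-≥1 G (subst T (trans (sym xv) (adj-sym G x v)) _))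

    pendantCount≡∑ : pendantCount G ≡ ∑[ x < n ] χ (isPendant G x)
    pendantCount≡∑ = trans (length-filterᵇ (isPendant G) (allFin n)) (sum-map-allFin (χ ∘ isPendant G))

    pendantNbrs-of-pendant : ∀ {x} → deg G x ≡ 1 → pendantNbrs G x ≡ 0
    pendantNbrs-of-pendant {x} dx = begin
      pendantNbrs G x                                 ≡⟨ pendantNbrs≡∑ G x ⟩
      ∑[ v < n ] χ (adj G x v ∧ isPendant G v)        ≡⟨ sum-cong-≗ no-pendant-neighbour ⟩
      ∑[ v < n ] 0                                    ≡⟨ sum-replicate-zero n ⟩
      0                                               ∎
      where
      open ≡-Reasoning
      no-pendant-neighbour : ∀ v → χ (adj G x v ∧ isPendant G v) ≡ 0
      no-pendant-neighbour v with adj G x v in xv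
      ... | false = refl
      ... | true  = cong χ (dec-false (deg G v ℕ.≟ 1)
                      (pendant-neighbour-not-pendant G connected 3≤n dx (subst T (sym xv) _)))

    incidence-square : ∀ x →
      χ (isInternal G x) * (2 * deg G x ∸ pendantNbrs G x) ^ 2 + χ (isPendant G x)
        ≡ incidence x * incidence x
    incidence-square x =
      trans (vertex-square (deg G x) (outdeg x) (pendantNbrs G x)
                           (outdeg+pendantNbrs x) pendantNbrs-of-pendant)
            (cong (λ k → (outdeg x + k) * (outdeg x + k)) (sym (indeg≡ x)))

    ∑-incidence-square : ∑[ x < n ] (incidence x * incidence x) ≡ internalSum G + pendantCount G
    ∑-incidence-square = begin
      ∑[ x < n ] (incidence x * incidence x)
        ≡⟨ sum-cong-≗ incidence-square ⟨
      ∑[ x < n ] (χ (isInternal G x) * square x + χ (isPendant G x))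
        ≡⟨ ∑-distrib-+ (λ x → χ (isInternal G x) * square x) (λ x → χ (isPendant G x)) ⟩
      ∑[ x < n ] (χ (isInternal G x) * square x) + ∑[ x < n ] χ (isPendant G x)
        ≡⟨ cong₂ _+_ (trans (sum-map-filterᵇ (isInternal G) square (allFin n))
                            (sum-map-allFin (λ x → χ (isInternal G x) * square x)))
                     pendantCount≡∑ ⟨
      internalSum G + pendantCount G ∎
      where
      open ≡-Reasoning
      square : Fin n → ℕ
      square x = (2 * deg G x ∸ pendantNbrs G x) ^ 2

    sum-map-A1Vertices : ∀ (g : Fin n × Fin n → ℕ) →
      sum (map g (A1Vertices G)) ≡ ⟪ (λ u v → g (u , v)) ⟫
    sum-map-A1Vertices g =
      trans (sum-map-filterᵇ _ g (allPairs G))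
            (trans (sum-map-allPairs G (λ p → χ (isArc G p ∧ shuntable G p) * g p))
                   (sum-cong-≗ λ u → sum-cong-≗ λ v → cong (_* g (u , v)) (vertex-weight u v)))
      where
      vertex-weight : ∀ u v → χ (isArc G (u , v) ∧ shuntable G (u , v)) ≡ w u v
      vertex-weight u v with adj G u v in uv
      ... | false = refl
      ... | true  = cong χ (shuntable≡isInternal G (subst T (sym uv) _))

    twice-A1EdgeCount : 2 * A1EdgeCount G + ⟪ (λ _ _ → 1) ⟫ ≡ ⟪ meeting ⟫
    twice-A1EdgeCount = begin
      2 * A1EdgeCount G + ⟪ (λ _ _ → 1) ⟫
        ≡⟨ cong (2 * A1EdgeCount G +_)
                (trans (length≡sum-map-1 (A1Vertices G)) (sum-map-A1Vertices (λ _ → 1))) ⟨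
      2 * A1EdgeCount G + length (A1Vertices G)
        ≡⟨ unorderedPairs-count G _meets_ meets-sym meets-refl (A1Vertices G) ⟩
      sum (map (λ a → sum (map (χ ∘ (a meets_)) (A1Vertices G))) (A1Vertices G))
        ≡⟨ sum-map-A1Vertices _ ⟩
      ⟪ (λ u v → sum (map (χ ∘ ((u , v) meets_)) (A1Vertices G))) ⟫
        ≡⟨ ⟪⟫-cong (λ u v _ → sum-map-A1Vertices (χ ∘ ((u , v) meets_))) ⟩
      ⟪ meeting ⟫ ∎
      where open ≡-Reasoning

    pendants-as-arcs : ⟪ (λ u v → χ (isPendant G u)) ⟫ ≡ pendantCount G
    pendants-as-arcs = begin
      ⟪ (λ u v → χ (isPendant G u)) ⟫           ≡⟨ ⟪⟫-source (χ ∘ isPendant G) ⟩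
      ∑[ u < n ] (χ (isPendant G u) * outdeg u) ≡⟨ sum-cong-≗ pendant-outdeg ⟩
      ∑[ u < n ] χ (isPendant G u)              ≡⟨ pendantCount≡∑ ⟨
      pendantCount G                            ∎
      where
      open ≡-Reasoning
      pendant-outdeg : ∀ u → χ (isPendant G u) * outdeg u ≡ χ (isPendant G u)
      pendant-outdeg u with isPendant G u in pu
      ... | false = refl
      ... | true  = begin
        outdeg u + 0               ≡⟨ cong (outdeg u +_) (pendantNbrs-of-pendant du) ⟨
        outdeg u + pendantNbrs G u ≡⟨ outdeg+pendantNbrs u ⟩
        deg G u                    ≡⟨ du ⟩
        1                          ∎
        where
        du : deg G u ≡ 1
        du = isPendant⇒deg≡1 G pu

    arcs+pendants : ⟪ (λ _ _ → 1) ⟫ + pendantCount G ≡ 2 * edgeCount G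
    arcs+pendants = begin
      ⟪ (λ _ _ → 1) ⟫ + pendantCount G
        ≡⟨ cong₂ _+_ (⟪⟫-target (λ _ → 1)) pendantCount≡∑ ⟩
      ∑[ v < n ] (1 * indeg v) + ∑[ v < n ] χ (isPendant G v)
        ≡⟨ ∑-distrib-+ (λ v → 1 * indeg v) (λ v → χ (isPendant G v)) ⟨
      ∑[ v < n ] (1 * indeg v + χ (isPendant G v))
        ≡⟨ sum-cong-≗ (λ v → trans (cong (_+ χ (isPendant G v))
                                        (trans (*-identityˡ (indeg v)) (indeg≡ v)))
                                  (internal*deg+pendant (deg G v))) ⟩
      ∑[ v < n ] deg G v
        ≡⟨ handshake G ⟩
      2 * edgeCount G ∎
      where open ≡-Reasoning

    reversible+pendants : ⟪ (λ u v → w v u) ⟫ + pendantCount G ≡ ⟪ (λ _ _ → 1) ⟫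
    reversible+pendants = begin
      ⟪ (λ u v → w v u) ⟫ + pendantCount G
        ≡⟨ cong (⟪ (λ u v → w v u) ⟫ +_) pendants-as-arcs ⟨
      ⟪ (λ u v → w v u) ⟫ + ⟪ (λ u v → χ (isPendant G u)) ⟫
        ≡⟨ ⟪⟫-+ (λ u v → w v u) (λ u v → χ (isPendant G u)) ⟨
      ⟪ (λ u v → w v u + χ (isPendant G u)) ⟫
        ≡⟨ ⟪⟫-cong tail-internal-or-pendant ⟩
      ⟪ (λ _ _ → 1) ⟫ ∎
      where
      open ≡-Reasoning
      tail-internal-or-pendant : ∀ u v → T (adj G u v ∧ isInternal G v) → w v u + χ (isPendant G u) ≡ 1
      tail-internal-or-pendant u v uv with Equivalence.to T-∧ uv
      ... | uv′ , _ = trans (cong (λ b → χ (b ∧ isInternal G u) + χ (isPendant G u))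
                                  (trans (adj-sym G v u) (Equivalence.to T-≡ uv′)))
                            (internal+pendant (deg-≥1 G uv′))

    A1EdgeCount-identity : 2 * A1EdgeCount G + 6 * edgeCount G ≡ internalSum G + 5 * pendantCount G
    A1EdgeCount-identity =
      eliminate {A1EdgeCount G} {m = edgeCount G}
        twice-A1EdgeCount (trans meeting-sum ∑-incidence-square) arcs+pendants reversible+pendants
      where
      eliminate : ∀ {E V M X S p m} → 2 * E + V ≡ M → M + V + X ≡ S + p → V + p ≡ 2 * m → X + p ≡ V →
                  2 * E + 6 * m ≡ S + 5 * p
      eliminate {E} {X = X} {S} {p} {m} refl squares arcs refl = begin
        2 * E + 6 * m                           ≡⟨ regroup₁ E m ⟩
        2 * E + 3 * (2 * m)                     ≡⟨ cong (λ k → 2 * E + 3 * k) arcs ⟨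
        2 * E + 3 * (X + p + p)                 ≡⟨ regroup₂ E X p ⟩
        2 * E + (X + p) + (X + p) + X + 4 * p   ≡⟨ cong (_+ 4 * p) squares ⟩
        S + p + 4 * p                           ≡⟨ regroup₃ S p ⟩
        S + 5 * p                               ∎
        where
        open ≡-Reasoning
        regroup₁ : ∀ E m → 2 * E + 6 * m ≡ 2 * E + 3 * (2 * m)
        regroup₁ = solve-∀
        regroup₂ : ∀ E X p → 2 * E + 3 * (X + p + p) ≡ 2 * E + (X + p) + (X + p) + X + 4 * p
        regroup₂ = solve-∀
        regroup₃ : ∀ S p → S + p + 4 * p ≡ S + 5 * p
        regroup₃ = solve-∀

open Counting using (module A₁-Counting)

open import Data.Nat using (ℕ; _≤_)
import Data.Nat as ℕ
open import Data.Integer using (ℤ; +_; _+_; _-_; _*_)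
open import Data.Integer.Properties using (pos-+; pos-*)
open import Data.Integer.Tactic.RingSolver using (solve-∀)
open import Relation.Binary.PropositionalEquality using (_≡_; cong; cong₂; trans; module ≡-Reasoning)

move-right : ∀ {a b : ℤ} c d → a + b ≡ c + d → a ≡ c - b + d
move-right {a} {b} c d a+b≡c+d = begin
  a             ≡⟨ cancel a b ⟩
  a + b - b     ≡⟨ cong (_- b) a+b≡c+d ⟩
  c + d - b     ≡⟨ swap c d b ⟩
  c - b + d     ∎
  where
  open ≡-Reasoning
  cancel : ∀ a b → a ≡ a + b - b
  cancel = solve-∀
  swap : ∀ c d b → c + d - b ≡ c - b + d
  swap = solve-∀

mainTheorem6 : (n : ℕ) → 3 ≤ n → (G : Graph n) → Connected G →
    (+ 2) * (+ A1EdgeCount G)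
      ≡ (+ internalSum G) - (+ 6) * (+ edgeCount G) + (+ 5) * (+ pendantCount G)
mainTheorem6 n 3≤n G connected = move-right (+ internalSum G) (+ 5 * + pendantCount G) (begin
  + 2 * + A1EdgeCount G + + 6 * + edgeCount G
    ≡⟨ cong₂ _+_ (pos-* 2 (A1EdgeCount G)) (pos-* 6 (edgeCount G)) ⟨
  + (2 ℕ.* A1EdgeCount G) + + (6 ℕ.* edgeCount G)
    ≡⟨ pos-+ (2 ℕ.* A1EdgeCount G) (6 ℕ.* edgeCount G) ⟨
  + (2 ℕ.* A1EdgeCount G ℕ.+ 6 ℕ.* edgeCount G)
    ≡⟨ cong +_ (A₁-Counting.A1EdgeCount-identity G connected 3≤n) ⟩
  + (internalSum G ℕ.+ 5 ℕ.* pendantCount G)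
    ≡⟨ trans (pos-+ (internalSum G) (5 ℕ.* pendantCount G))
             (cong (_+_ (+ internalSum G)) (pos-* 5 (pendantCount G))) ⟩
  + internalSum G + + 5 * + pendantCount G ∎)
  where open ≡-Reasoning
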